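{- Let $\mathcal{H}$ be a minor-closed graph class. Then for every $k\in\mathbb{N}$, the class $\mathcal{H}^{(k)}$ is minor-closed.
   Context: All graphs are finite, simple and undirected. For a graph $G$ and $X\subseteq V(G)$, $G/\!\!/X$ is obtained from $G$ by deleting $X$ and adding a new vertex adjacent to every vertex of $N_G(X)=\bigcup_{v\in X}N_G(v)\setminus X$. For a partition $\mathcal{X}=\{X_1,\dots,X_p\}$ of some subset of $V(G)$ into non-empty parts, $G/\!\!/\mathcal{X}:=G/\!\!/X_1\cdots/\!\!/X_p$, and its order is $|X_1\cup\dots\cup X_p|$. $\mathcal{H}^{(k)}$ is the class of graphs $G$ admitting such a partition $\mathcal{X}$ of order at most $k$ with $G/\!\!/\mathcal{X}\in\mathcal{H}$. A class is minor-closed if it contains all minors of its members. -}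

module Defs where

open import Data.Bool using (Bool; true; false; _∧_)
open import Data.Bool.Properties using () renaming (_≟_ to _≟ᵇ_)
open import Data.Nat using (ℕ; zero; suc; _≤_)
open import Data.Unit using (⊤; tt)
open import Data.Empty using (⊥)
open import Data.Sum using (_⊎_; inj₁; inj₂)
open import Data.Product using (Σ; Σ-syntax; ∃; ∃-syntax; _×_; _,_; proj₁)
open import Data.List using (List; []; _∷_; map; filterᵇ; length)
open import Data.Bool.ListAction using (any)
open import Data.List.Relation.Unary.All using (All; []; _∷_)
import Data.List.Relation.Unary.All as All
open import Data.List.Relation.Unary.Any using (here; there)
open import Data.List.Relation.Unary.AllPairs using (AllPairs; []; _∷_)
open import Data.List.Membership.Propositional using (_∈_)
open import Data.List.Membership.Propositional.Properties using (∈-map⁺)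
open import Data.List.Relation.Unary.Unique.Propositional using (Unique)
import Data.List.Relation.Unary.Unique.Propositional.Properties as UniqueP
open import Relation.Nullary using (¬_)
open import Relation.Binary.PropositionalEquality using (_≡_; _≢_; refl; sym; trans; cong)
open import Axiom.UniquenessOfIdentityProofs using (module Decidable⇒UIP)

-- Vertex set: an arbitrary type V together with a duplicate-free list
-- containing every vertex (so V is finite, |V| = length vertices).

record Graph : Set₁ where
  field
    V        : Set
    E        : V → V → Bool
    E-sym    : ∀ u v → E u v ≡ E v u
    E-irrefl : ∀ v → E v v ≡ false
    vertices : List V
    unique   : Unique vertices
    complete : ∀ v → v ∈ vertices
open Graph public

Subset : Graph → Set
Subset G = V G → Bool

NonEmpty : (G : Graph) → Subset G → Set
NonEmpty G X = ∃[ v ] X v ≡ true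

Disjoint : (G : Graph) → Subset G → Subset G → Set
Disjoint G X Y = ∀ v → X v ≡ true → Y v ≡ false

-- The operation G // X : delete X and add a new vertex adjacent to
-- every vertex of N_G(X) = (⋃_{v∈X} N_G(v)) \ X.
-- Vertex set of G // X : (V(G) \ X) ⊎ {new vertex}.

module _ {A : Set} (X : A → Bool) where
  keepStep : (v : A) (b : Bool) → X v ≡ b → List (Σ A λ v → X v ≡ false) → List (Σ A λ v → X v ≡ false)
  keepStep v true  _ r = r
  keepStep v false e r = (v , e) ∷ r

  keep : List A → List (Σ A λ v → X v ≡ false)
  keep [] = []
  keep (v ∷ vs) = keepStep v (X v) refl (keep vs)

  keep-All : ∀ {P : A → Set} {vs} → All P vs → All (λ p → P (proj₁ p)) (keep vs)
  keep-All {vs = []} [] = []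
  keep-All {P} {vs = v ∷ vs} (pv ∷ ps) = go (X v) refl
    where
    go : ∀ b (e : X v ≡ b) → All (λ p → P (proj₁ p)) (keepStep v b e (keep vs))
    go true  e = keep-All ps
    go false e = pv ∷ keep-All ps

  keep-unique : ∀ {vs} → Unique vs → Unique (keep vs)
  keep-unique {[]} [] = []
  keep-unique {v ∷ vs} (ne ∷ u) = go (X v) refl
    where
    go : ∀ b (e : X v ≡ b) → Unique (keepStep v b e (keep vs))
    go true  e = keep-unique u
    go false e = All.map (λ n eq → n (cong proj₁ eq)) (keep-All ne) ∷ keep-unique u

  keep-complete : ∀ {vs} v (p : X v ≡ false) → v ∈ vs → (v , p) ∈ keep vs
  keep-complete {w ∷ vs} v p (here refl) = go (X v) refl
    where
    go : ∀ b (e : X v ≡ b) → (v , p) ∈ keepStep v b e (keep vs)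
    go true  e with () ← trans (sym e) p
    go false e = here (cong (v ,_) (Decidable⇒UIP.≡-irrelevant _≟ᵇ_ p e))
  keep-complete {w ∷ vs} v p (there m) = go (X w) refl
    where
    go : ∀ b (e : X w ≡ b) → (v , p) ∈ keepStep w b e (keep vs)
    go true  e = keep-complete v p m
    go false e = there (keep-complete v p m)

module _ (G : Graph) (X : Subset G) where
  inN : V G → Bool
  inN u = any (λ w → X w ∧ E G u w) (vertices G)

  ContrV : Set
  ContrV = (Σ (V G) λ v → X v ≡ false) ⊎ ⊤

  contrE : ContrV → ContrV → Bool
  contrE (inj₁ (u , _)) (inj₁ (v , _)) = E G u v
  contrE (inj₁ (u , _)) (inj₂ _)       = inN u
  contrE (inj₂ _)       (inj₁ (v , _)) = inN v
  contrE (inj₂ _)       (inj₂ _)       = false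

  contrE-sym : ∀ a b → contrE a b ≡ contrE b a
  contrE-sym (inj₁ (u , _)) (inj₁ (v , _)) = E-sym G u v
  contrE-sym (inj₁ _) (inj₂ _) = refl
  contrE-sym (inj₂ _) (inj₁ _) = refl
  contrE-sym (inj₂ _) (inj₂ _) = refl

  contrE-irrefl : ∀ a → contrE a a ≡ false
  contrE-irrefl (inj₁ (u , _)) = E-irrefl G u
  contrE-irrefl (inj₂ _) = refl

  private
    ks : List (Σ (V G) λ v → X v ≡ false)
    ks = keep X (vertices G)

    inj₁-inj : ∀ {a b : Σ (V G) λ v → X v ≡ false} → inj₁ {B = ⊤} a ≡ inj₁ b → a ≡ b
    inj₁-inj refl = refl

    new≢ : ∀ {a : Σ (V G) λ v → X v ≡ false} → inj₂ tt ≢ inj₁ a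
    new≢ ()

    allNew : ∀ (ys : List (Σ (V G) λ v → X v ≡ false)) → All (λ b → inj₂ tt ≢ b) (map inj₁ ys)
    allNew [] = []
    allNew (y ∷ ys) = new≢ ∷ allNew ys

  contrVertices : List ContrV
  contrVertices = inj₂ tt ∷ map inj₁ ks

  contrUnique : Unique contrVertices
  contrUnique = allNew ks ∷ UniqueP.map⁺ inj₁-inj (keep-unique X (unique G))

  contrComplete : ∀ a → a ∈ contrVertices
  contrComplete (inj₁ (v , p)) = there (∈-map⁺ inj₁ (keep-complete X v p (complete G v)))
  contrComplete (inj₂ tt) = here refl

_//_ : (G : Graph) → Subset G → Graph
G // X = record
  { V = ContrV G X ; E = contrE G X ; E-sym = contrE-sym G X
  ; E-irrefl = contrE-irrefl G X ; vertices = contrVertices G X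
  ; unique = contrUnique G X ; complete = contrComplete G X }

transport : (G : Graph) (X : Subset G) → Subset G → Subset (G // X)
transport G X Y (inj₁ (v , _)) = Y v
transport G X Y (inj₂ _)       = false

-- G //[ X₁ , … , X_p ] = G // X₁ // X₂ ⋯ // X_p  (each later part transported)
-- (defined with a fuel argument equal to the number of parts, to make
-- termination evident; map preserves length, so the fuel is exact)
contractAll : ℕ → (G : Graph) → List (Subset G) → Graph
contractAll zero    G _        = G
contractAll (suc n) G []       = G
contractAll (suc n) G (X ∷ Xs) = contractAll n (G // X) (map (transport G X) Xs)

_//*_ : (G : Graph) → List (Subset G) → Graph
G //* 𝒳 = contractAll (length 𝒳) G 𝒳

IsPartition : (G : Graph) → List (Subset G) → Set
IsPartition G 𝒳 = All (NonEmpty G) 𝒳 × AllPairs (Disjoint G) 𝒳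

order : (G : Graph) → List (Subset G) → ℕ
order G 𝒳 = length (filterᵇ (λ v → any (λ X → X v) 𝒳) (vertices G))

_^[_] : (Graph → Set) → ℕ → (Graph → Set)
(ℋ ^[ k ]) G = Σ[ 𝒳 ∈ List (Subset G) ] IsPartition G 𝒳 × order G 𝒳 ≤ k × ℋ (G //* 𝒳)

data WalkIn (G : Graph) (B : Subset G) : V G → V G → Set where
  stop : ∀ {x} → WalkIn G B x x
  step : ∀ {x y z} → E G x y ≡ true → B y ≡ true → WalkIn G B y z → WalkIn G B x z

ConnectedIn : (G : Graph) → Subset G → Set
ConnectedIn G B = ∀ x y → B x ≡ true → B y ≡ true → WalkIn G B x y

record MinorModel (H G : Graph) : Set where
  field
    branch    : V H → Subset G
    nonempty  : ∀ h → NonEmpty G (branch h)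
    connected : ∀ h → ConnectedIn G (branch h)
    disjoint  : ∀ h h' → h ≢ h' → Disjoint G (branch h) (branch h')
    edges     : ∀ h h' → E H h h' ≡ true →
                ∃[ g ] ∃[ g' ] (branch h g ≡ true × branch h' g' ≡ true × E G g g' ≡ true)

_≼_ : Graph → Graph → Set
H ≼ G = MinorModel H G

MinorClosed : (Graph → Set) → Set₁
MinorClosed 𝒞 = ∀ G H → 𝒞 G → H ≼ G → 𝒞 H

-- Let 𝒳 witness G ∈ ℋ^(k) and let (B_h) be a model of H in G. Call h and h'
-- linked when B_h and B_h' meet a common part of 𝒳, and let 𝒴 consist of the
-- classes of the equivalence relation generated by linking, restricted to the
-- vertices whose branch set meets ⋃𝒳. The branch sets are disjoint, so
-- |⋃𝒴| ≤ |⋃𝒳| ≤ k. For a vertex a of H //* 𝒴, the image in G //* 𝒳 of the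
-- union of the B_h with h ↦ a is connected (linked branch sets are glued by a
-- contracted vertex), and these images form a model of H //* 𝒴 in G //* 𝒳.
-- Hence H //* 𝒴 ∈ ℋ, since ℋ is minor-closed.
module Submission where

open import Defs
open import Axiom.UniquenessOfIdentityProofs using (module Decidable⇒UIP)
open import Data.Bool using (Bool; true; false; not; _∧_; _∨_)
open import Data.Bool.ListAction using (any)
open import Data.Bool.Properties
  using (∧-conicalˡ; ∧-conicalʳ; ∨-sel; ∨-zeroʳ; ¬-not; not-¬; T-≡; T-not-≡)
  renaming (_≟_ to _≟ᵇ_)
open import Data.Empty using (⊥-elim)
import Data.Fin.Properties as Fin
open import Data.List using (List; []; _∷_; map; filterᵇ; length)
open import Data.List.Properties using (length-map; length-removeAt′)
open import Data.List.Membership.Propositional using (_∈_; _─_; find; lose)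
open import Data.List.Membership.Propositional.Properties
  using (∈-filter⁺; ∈-filter⁻; ∈-map⁺)
import Data.List.Membership.Setoid.Properties as SetoidMembership
open import Data.List.Relation.Unary.All using (All; []; _∷_)
import Data.List.Relation.Unary.All as All
import Data.List.Relation.Unary.All.Properties as All
open import Data.List.Relation.Unary.AllPairs using (AllPairs; []; _∷_)
import Data.List.Relation.Unary.AllPairs as AllPairs
import Data.List.Relation.Unary.AllPairs.Properties as AllPairs
open import Data.List.Relation.Unary.Any using (Any; here; there; index)
import Data.List.Relation.Unary.Any as Any
import Data.List.Relation.Unary.Any.Properties as Any
open import Data.List.Relation.Unary.Unique.Propositional using (Unique)
import Data.List.Relation.Unary.Unique.Propositional.Properties as Unique
open import Data.Nat using (ℕ; zero; suc; _≤_; z≤n; s≤s)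
open import Data.Nat.Properties using (≤-trans; ≤-reflexive; suc-injective)
open import Data.Product using (∃-syntax; _×_; _,_; proj₂; swap)
import Data.Product as Product
open import Data.Sum using (_⊎_; inj₁; inj₂)
import Data.Sum as Sum
open import Data.Unit using (tt)
open import Function using (_∘_)
open import Function.Bundles using (Equivalence)
open import Relation.Binary.Construct.Closure.ReflexiveTransitive using (Star; ε; _◅_; _◅◅_)
import Relation.Binary.Construct.Closure.ReflexiveTransitive as Star
open import Relation.Binary.Definitions using (DecidableEquality)
open import Relation.Binary.PropositionalEquality
  using (_≡_; _≢_; refl; sym; trans; cong; cong₂; subst; setoid)
open import Relation.Nullary using (Dec; yes; no; does)
open import Relation.Nullary.Decidable using (dec-true)
import Relation.Nullary.Decidable as Dec
open import Relation.Nullary.Decidable.Core using (T?)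

∨-≡-true⁻ : ∀ a {b} → a ∨ b ≡ true → a ≡ true ⊎ b ≡ true
∨-≡-true⁻ a {b} e = Sum.map (λ q → trans (sym q) e) (λ q → trans (sym q) e) (∨-sel a b)

∧-≡-true⁻ : ∀ a {b} → a ∧ b ≡ true → a ≡ true × b ≡ true
∧-≡-true⁻ a {b} e = ∧-conicalˡ a b e , ∧-conicalʳ a b e

does-≡-true⁻ : ∀ {P : Set} (p? : Dec P) → does p? ≡ true → P
does-≡-true⁻ (yes p) _  = p
does-≡-true⁻ (no _)  ()

module _ {A : Set} where

  any-≡-true⁺ : ∀ (p : A → Bool) {x xs} → x ∈ xs → p x ≡ true → any p xs ≡ true
  any-≡-true⁺ p x∈xs px = Equivalence.to T-≡ (Any.any⁺ p (lose x∈xs (Equivalence.from T-≡ px)))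

  any-≡-true⁻ : ∀ (p : A → Bool) xs → any p xs ≡ true → ∃[ x ] x ∈ xs × p x ≡ true
  any-≡-true⁻ p xs e = Product.map₂ (Product.map₂ (Equivalence.to T-≡))
    (find (Any.any⁻ p xs (Equivalence.from T-≡ e)))

  ∈-filterᵇ⁺ : ∀ (p : A → Bool) {x xs} → x ∈ xs → p x ≡ true → x ∈ filterᵇ p xs
  ∈-filterᵇ⁺ p x∈xs px = ∈-filter⁺ (T? ∘ p) x∈xs (Equivalence.from T-≡ px)

  ∈-filterᵇ⁻ : ∀ (p : A → Bool) xs {x} → x ∈ filterᵇ p xs → x ∈ xs × p x ≡ true
  ∈-filterᵇ⁻ p _ x∈ = Product.map₂ (Equivalence.to T-≡) (∈-filter⁻ (T? ∘ p) x∈)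

  ∈-─⁺ : ∀ {x y : A} {xs} (x∈xs : x ∈ xs) → y ∈ xs → y ≢ x → y ∈ xs ─ x∈xs
  ∈-─⁺ (here refl)  (here refl)  y≢x = ⊥-elim (y≢x refl)
  ∈-─⁺ (here refl)  (there y∈xs) _   = y∈xs
  ∈-─⁺ (there _)    (here refl)  _   = here refl
  ∈-─⁺ (there x∈xs) (there y∈xs) y≢x = there (∈-─⁺ x∈xs y∈xs y≢x)

  ≡-dec-of-enumeration : ∀ {xs} → (∀ x → x ∈ xs) → DecidableEquality A
  ≡-dec-of-enumeration complete x y =
    Dec.map′ (SetoidMembership.index-injective (setoid A) (complete x) (complete y))
             (cong (index ∘ complete))
             (index (complete x) Fin.≟ index (complete y))

pigeonhole : ∀ {A B : Set} (R : A → B → Set) → (∀ {x x' y} → R x y → R x' y → x ≡ x') →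
             ∀ {xs} ys → Unique xs → (∀ {x} → x ∈ xs → ∃[ y ] y ∈ ys × R x y) →
             length xs ≤ length ys
pigeonhole R R-injective {[]} ys _ _ = z≤n
pigeonhole R R-injective {x ∷ xs} ys (x∉xs ∷ xs!) image with image (here refl)
... | y , y∈ys , Rxy =
  ≤-trans (s≤s (pigeonhole R R-injective (ys ─ y∈ys) xs! image′))
          (≤-reflexive (sym (length-removeAt′ ys (index y∈ys))))
  where
  image′ : ∀ {x'} → x' ∈ xs → ∃[ y' ] y' ∈ ys ─ y∈ys × R x' y'
  image′ x'∈xs with image (there x'∈xs)
  ... | y' , y'∈ys , Rx'y' =
    y' , ∈-─⁺ y∈ys y'∈ys (λ { refl → All.lookup x∉xs x'∈xs (R-injective Rxy Rx'y') }) , Rx'y'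

vertex-≟ : (G : Graph) → DecidableEquality (V G)
vertex-≟ G = ≡-dec-of-enumeration (complete G)

covered : (G : Graph) → List (Subset G) → Subset G
covered G 𝒳 v = any (λ X → X v) 𝒳

SamePart : (G : Graph) → List (Subset G) → V G → V G → Set
SamePart G 𝒳 u v = Any (λ X → X u ≡ true × X v ≡ true) 𝒳

SamePart-sym : ∀ {G 𝒳 u v} → SamePart G 𝒳 u v → SamePart G 𝒳 v u
SamePart-sym {G} {𝒳} {u} {v} = Any.map {P = λ X → X u ≡ true × X v ≡ true} swap

shared-vertex⇒same-part : ∀ {G 𝒳 X X' v} → AllPairs (Disjoint G) 𝒳 → X ∈ 𝒳 → X' ∈ 𝒳 →
                          X v ≡ true → X' v ≡ true → X ≡ X'
shared-vertex⇒same-part _ (here refl) (here refl) _ _ = refl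
shared-vertex⇒same-part {v = v} (d ∷ _) (here refl) (there X'∈) Xv X'v =
  ⊥-elim (not-¬ X'v (All.lookup d X'∈ v Xv))
shared-vertex⇒same-part {v = v} (d ∷ _) (there X∈) (here refl) Xv X'v =
  ⊥-elim (not-¬ Xv (All.lookup d X∈ v X'v))
shared-vertex⇒same-part {G} {v = v} (_ ∷ ds) (there X∈) (there X'∈) Xv X'v =
  shared-vertex⇒same-part {G} {v = v} ds X∈ X'∈ Xv X'v

walk-++ : ∀ {G B x y z} → WalkIn G B x y → WalkIn G B y z → WalkIn G B x z
walk-++ stop         w′ = w′
walk-++ (step e b w) w′ = step e b (walk-++ w w′)

-- K is G with the parts of 𝒳 contracted, up to isomorphism, and π is the quotient map.
record ContractionMap (G : Graph) (𝒳 : List (Subset G)) (K : Graph) : Set where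
  field
    π              : V G → V K
    surjective     : ∀ a → ∃[ g ] π g ≡ a
    edge-lift      : ∀ {a b} → E K a b ≡ true →
                     ∃[ g ] ∃[ g' ] π g ≡ a × π g' ≡ b × E G g g' ≡ true
    fibre          : ∀ {g g'} → π g ≡ π g' → g ≡ g' ⊎ SamePart G 𝒳 g g'
    merges         : ∀ {g g'} → SamePart G 𝒳 g g' → π g ≡ π g'
    edge-preserved : ∀ {g g'} → E G g g' ≡ true → π g ≢ π g' → E K (π g) (π g') ≡ true

id-contraction : (G : Graph) → ContractionMap G [] G
id-contraction G = record
  { π              = λ g → g
  ; surjective     = λ a → a , refl
  ; edge-lift      = λ {a} {b} e → a , b , refl , refl , e
  ; fibre          = inj₁
  ; merges         = λ ()
  ; edge-preserved = λ e _ → e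
  }

module OneContraction (G : Graph) (X : Subset G) where

  private
    ι-by : ∀ g b → X g ≡ b → V (G // X)
    ι-by g false Xg = inj₁ (g , Xg)
    ι-by g true  _  = inj₂ tt

  ι : V G → V (G // X)
  ι g = ι-by g (X g) refl

  data ιView (g : V G) : V (G // X) → Set where
    outside : (Xg : X g ≡ false) → ιView g (inj₁ (g , Xg))
    inside  : X g ≡ true → ιView g (inj₂ tt)

  ι-view : ∀ g → ιView g (ι g)
  ι-view g = view (X g) refl
    where
    view : ∀ b (Xg : X g ≡ b) → ιView g (ι-by g b Xg)
    view false Xg = outside Xg
    view true  Xg = inside Xg

  ι-outside : ∀ {g} (Xg : X g ≡ false) → ι g ≡ inj₁ (g , Xg)
  ι-outside {g} Xg with ι g | ι-view g
  ... | _ | outside Xg′ = cong (λ p → inj₁ (g , p)) (Decidable⇒UIP.≡-irrelevant _≟ᵇ_ Xg′ Xg)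
  ... | _ | inside Xg′  = ⊥-elim (not-¬ Xg′ Xg)

  ι-inside : ∀ {g} → X g ≡ true → ι g ≡ inj₂ tt
  ι-inside {g} Xg with ι g | ι-view g
  ... | _ | outside Xg′ = ⊥-elim (not-¬ Xg Xg′)
  ... | _ | inside _    = refl

  ι-surjective : NonEmpty G X → ∀ u → ∃[ g ] ι g ≡ u
  ι-surjective _        (inj₁ (g , Xg)) = g , ι-outside Xg
  ι-surjective (x , Xx) (inj₂ tt)       = x , ι-inside Xx

  ι-fibre : ∀ {g g'} → ι g ≡ ι g' → g ≡ g' ⊎ (X g ≡ true × X g' ≡ true)
  ι-fibre {g} {g'} eq with ι g | ι-view g | ι g' | ι-view g'
  ι-fibre refl | _ | outside _ | _ | outside _ = inj₁ refl
  ι-fibre ()   | _ | outside _ | _ | inside _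
  ι-fibre ()   | _ | inside _  | _ | outside _
  ι-fibre _    | _ | inside Xg | _ | inside Xg' = inj₂ (Xg , Xg')

  edge-lift : ∀ {u w} → E (G // X) u w ≡ true →
              ∃[ g ] ∃[ g' ] ι g ≡ u × ι g' ≡ w × E G g g' ≡ true
  edge-lift {inj₁ (u , Xu)} {inj₁ (w , Xw)} e = u , w , ι-outside Xu , ι-outside Xw , e
  edge-lift {inj₁ (u , Xu)} {inj₂ tt} e with any-≡-true⁻ _ (vertices G) e
  ... | w , _ , Xw∧uw with ∧-≡-true⁻ (X w) Xw∧uw
  ...   | Xw , uw = u , w , ι-outside Xu , ι-inside Xw , uw
  edge-lift {inj₂ tt} {inj₁ (w , Xw)} e with any-≡-true⁻ _ (vertices G) e
  ... | u , _ , Xu∧wu with ∧-≡-true⁻ (X u) Xu∧wu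
  ...   | Xu , wu = u , w , ι-inside Xu , ι-outside Xw , trans (E-sym G u w) wu

  edge-preserved : ∀ {g g'} → E G g g' ≡ true → ι g ≢ ι g' → E (G // X) (ι g) (ι g') ≡ true
  edge-preserved {g} {g'} e ι≢ with ι g | ι-view g | ι g' | ι-view g'
  ... | _ | outside _ | _ | outside _ = e
  ... | _ | outside _ | _ | inside Xg' =
    any-≡-true⁺ (λ w → X w ∧ E G g w) (complete G g') (cong₂ _∧_ Xg' e)
  ... | _ | inside Xg | _ | outside _ =
    any-≡-true⁺ (λ w → X w ∧ E G g' w) (complete G g) (cong₂ _∧_ Xg (trans (E-sym G g' g) e))
  ... | _ | inside _  | _ | inside _ = ⊥-elim (ι≢ refl)

  transport-ι⁻ : ∀ Y {g} → transport G X Y (ι g) ≡ true → Y g ≡ true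
  transport-ι⁻ Y {g} Yg with ι g | ι-view g
  ... | _ | outside _ = Yg

  transport-ι⁺ : ∀ {Y g} → Disjoint G X Y → Y g ≡ true → transport G X Y (ι g) ≡ true
  transport-ι⁺ {Y} {g} X∩Y=∅ Yg with ι g | ι-view g
  ... | _ | outside _ = Yg
  ... | _ | inside Xg = ⊥-elim (not-¬ Yg (X∩Y=∅ g Xg))

  transport-partition : ∀ {Xs} → IsPartition G (X ∷ Xs) →
                        IsPartition (G // X) (map (transport G X) Xs)
  transport-partition (_ ∷ nonempty , X∩ ∷ pairwise) =
    All.map⁺ (All.zipWith transported-nonempty (nonempty , X∩)) ,
    AllPairs.map⁺ (AllPairs.map transported-disjoint pairwise)
    where
    transported-nonempty : ∀ {Y} → NonEmpty G Y × Disjoint G X Y →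
                           NonEmpty (G // X) (transport G X Y)
    transported-nonempty ((v , Yv) , X∩Y=∅) = inj₁ (v , ¬-not (λ Xv → not-¬ Yv (X∩Y=∅ v Xv))) , Yv
    transported-disjoint : ∀ {Y Y'} → Disjoint G Y Y' →
                           Disjoint (G // X) (transport G X Y) (transport G X Y')
    transported-disjoint Y∩Y'=∅ (inj₁ (v , _)) = Y∩Y'=∅ v

  transport-SamePart : ∀ {Xs g g'} → All (Disjoint G X) Xs → SamePart G Xs g g' →
                       SamePart (G // X) (map (transport G X) Xs) (ι g) (ι g')
  transport-SamePart X∩ same with find same
  ... | Y , Y∈ , (Yg , Yg') =
    lose (∈-map⁺ (transport G X) Y∈)
         (transport-ι⁺ (All.lookup X∩ Y∈) Yg , transport-ι⁺ (All.lookup X∩ Y∈) Yg')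

∷-contraction : ∀ {G X Xs K} → IsPartition G (X ∷ Xs) →
                ContractionMap (G // X) (map (transport G X) Xs) K → ContractionMap G (X ∷ Xs) K
∷-contraction {G} {X} {Xs} {K} (X≠∅ ∷ _ , X∩ ∷ _) κ = record
  { π              = κ.π ∘ ι
  ; surjective     = surjective
  ; edge-lift      = edge-lift
  ; fibre          = fibre
  ; merges         = merges
  ; edge-preserved = λ e π≢ → κ.edge-preserved (ι.edge-preserved e (π≢ ∘ cong κ.π)) π≢
  }
  where
  module κ = ContractionMap κ
  module ι = OneContraction G X
  open ι using (ι)

  surjective : ∀ a → ∃[ g ] κ.π (ι g) ≡ a
  surjective a with κ.surjective a
  ... | u , κu≡a with ι.ι-surjective X≠∅ u
  ...   | g , ιg≡u = g , trans (cong κ.π ιg≡u) κu≡a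

  edge-lift : ∀ {a b} → E K a b ≡ true →
              ∃[ g ] ∃[ g' ] κ.π (ι g) ≡ a × κ.π (ι g') ≡ b × E G g g' ≡ true
  edge-lift e with κ.edge-lift e
  ... | u , w , κu≡a , κw≡b , e′ with ι.edge-lift e′
  ...   | g , g' , ιg≡u , ιg'≡w , e″ =
    g , g' , trans (cong κ.π ιg≡u) κu≡a , trans (cong κ.π ιg'≡w) κw≡b , e″

  fibre : ∀ {g g'} → κ.π (ι g) ≡ κ.π (ι g') → g ≡ g' ⊎ SamePart G (X ∷ Xs) g g'
  fibre eq with κ.fibre eq
  ... | inj₂ same = inj₂ (there (Any.map (Product.map (ι.transport-ι⁻ _) (ι.transport-ι⁻ _))
                                         (Any.map⁻ same)))
  ... | inj₁ ι≡ with ι.ι-fibre ι≡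
  ...   | inj₁ g≡g'        = inj₁ g≡g'
  ...   | inj₂ (Xg , Xg') = inj₂ (here (Xg , Xg'))

  merges : ∀ {g g'} → SamePart G (X ∷ Xs) g g' → κ.π (ι g) ≡ κ.π (ι g')
  merges (here (Xg , Xg')) = cong κ.π (trans (ι.ι-inside Xg) (sym (ι.ι-inside Xg')))
  merges (there same)      = κ.merges (ι.transport-SamePart X∩ same)

contractAll-contraction : ∀ n G 𝒳 → length 𝒳 ≡ n → IsPartition G 𝒳 →
                          ContractionMap G 𝒳 (contractAll n G 𝒳)
contractAll-contraction zero    G []       _   _         = id-contraction G
contractAll-contraction (suc n) G (X ∷ Xs) len partition =
  ∷-contraction partition
    (contractAll-contraction n (G // X) (map (transport G X) Xs)
      (trans (length-map (transport G X) Xs) (suc-injective len))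
      (OneContraction.transport-partition G X partition))

//*-contraction : ∀ {G 𝒳} → IsPartition G 𝒳 → ContractionMap G 𝒳 (G //* 𝒳)
//*-contraction {G} {𝒳} = contractAll-contraction (length 𝒳) G 𝒳 refl

module Merge (H : Graph) where

  meets : Subset H → Subset H → Bool
  meets Y S = any (λ v → Y v ∧ S v) (vertices H)

  meets⁺ : ∀ {Y S} v → Y v ≡ true → S v ≡ true → meets Y S ≡ true
  meets⁺ {Y} {S} v Yv Sv = any-≡-true⁺ (λ v → Y v ∧ S v) (complete H v) (cong₂ _∧_ Yv Sv)

  meets⁻ : ∀ {Y S} → meets Y S ≡ true → ∃[ v ] Y v ≡ true × S v ≡ true
  meets⁻ {Y} m with any-≡-true⁻ _ (vertices H) m
  ... | v , _ , Yv∧Sv = v , ∧-≡-true⁻ (Y v) Yv∧Sv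

  absorb : Subset H → List (Subset H) → Subset H
  absorb S 𝒴 v = S v ∨ any (λ Y → meets Y S ∧ Y v) 𝒴

  absorb⁺ˡ : ∀ {S} 𝒴 {v} → S v ≡ true → absorb S 𝒴 v ≡ true
  absorb⁺ˡ {S} 𝒴 {v} Sv = cong (_∨ any (λ Y → meets Y S ∧ Y v) 𝒴) Sv

  absorb⁺ʳ : ∀ {S 𝒴 Y v} → Y ∈ 𝒴 → meets Y S ≡ true → Y v ≡ true → absorb S 𝒴 v ≡ true
  absorb⁺ʳ {S} {𝒴} {Y} {v} Y∈ m Yv =
    trans (cong (S v ∨_) (any-≡-true⁺ (λ Y → meets Y S ∧ Y v) Y∈ (cong₂ _∧_ m Yv))) (∨-zeroʳ (S v))

  absorb⁻ : ∀ {S 𝒴 v} → absorb S 𝒴 v ≡ true →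
            S v ≡ true ⊎ ∃[ Y ] Y ∈ 𝒴 × meets Y S ≡ true × Y v ≡ true
  absorb⁻ {S} {𝒴} {v} a with ∨-≡-true⁻ (S v) a
  ... | inj₁ Sv = inj₁ Sv
  ... | inj₂ any≡ with any-≡-true⁻ _ 𝒴 any≡
  ...   | Y , Y∈ , m∧Yv = inj₂ (Y , Y∈ , ∧-≡-true⁻ (meets Y S) m∧Yv)

  avoids : Subset H → Subset H → Bool
  avoids S Y = not (meets Y S)

  -- Its parts are the classes, on ⋃ Ss, of the equivalence generated by SamePart H Ss.
  merge : List (Subset H) → List (Subset H)
  merge []       = []
  merge (S ∷ Ss) = absorb S (merge Ss) ∷ filterᵇ (avoids S) (merge Ss)

  absorb-disjoint : ∀ {S 𝒴 Y} → AllPairs (Disjoint H) 𝒴 → Y ∈ 𝒴 → meets Y S ≡ false →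
                    Disjoint H (absorb S 𝒴) Y
  absorb-disjoint {S} {𝒴} {Y} 𝒴-disjoint Y∈ ¬m v a =
    ¬-not λ Yv → not-¬ (Y-meets-S Yv (absorb⁻ a)) ¬m
    where
    Y-meets-S : Y v ≡ true → S v ≡ true ⊎ ∃[ Y' ] Y' ∈ 𝒴 × meets Y' S ≡ true × Y' v ≡ true →
                meets Y S ≡ true
    Y-meets-S Yv (inj₁ Sv)                    = meets⁺ {Y} {S} v Yv Sv
    Y-meets-S Yv (inj₂ (Y' , Y'∈ , m' , Y'v)) =
      subst (λ Z → meets Z S ≡ true) (shared-vertex⇒same-part {H} 𝒴-disjoint Y'∈ Y∈ Y'v Yv) m'

  merge-disjoint : ∀ Ss → AllPairs (Disjoint H) (merge Ss)
  merge-disjoint []       = []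
  merge-disjoint (S ∷ Ss) =
    All.tabulate absorbed-disjoint ∷ AllPairs.filter⁺ (T? ∘ avoids S) (merge-disjoint Ss)
    where
    absorbed-disjoint : ∀ {Y} → Y ∈ filterᵇ (avoids S) (merge Ss) →
                        Disjoint H (absorb S (merge Ss)) Y
    absorbed-disjoint Y∈ with ∈-filter⁻ (T? ∘ avoids S) Y∈
    ... | Y∈′ , S-avoids-Y =
      absorb-disjoint (merge-disjoint Ss) Y∈′ (Equivalence.to T-not-≡ S-avoids-Y)

  merge-covered : ∀ Ss {v} → Any (λ Y → Y v ≡ true) (merge Ss) → Any (λ S → S v ≡ true) Ss
  merge-covered (S ∷ Ss) (here a) with absorb⁻ a
  ... | inj₁ Sv                 = here Sv
  ... | inj₂ (Y , Y∈ , _ , Yv) = there (merge-covered Ss (lose Y∈ Yv))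
  merge-covered (S ∷ Ss) (there p) = there (merge-covered Ss (Any.filter⁻ (T? ∘ avoids S) p))

  merge-coarsens : ∀ Ss {u v} → SamePart H Ss u v → SamePart H (merge Ss) u v
  merge-coarsens (S ∷ Ss) (here (Su , Sv)) = here (absorb⁺ˡ (merge Ss) Su , absorb⁺ˡ (merge Ss) Sv)
  merge-coarsens (S ∷ Ss) (there same) with find (merge-coarsens Ss same)
  ... | Y , Y∈ , (Yu , Yv) with meets Y S in m
  ...   | true  = here (absorb⁺ʳ Y∈ m Yu , absorb⁺ʳ Y∈ m Yv)
  ...   | false = there (lose (∈-filter⁺ _ Y∈ (Equivalence.from T-not-≡ m)) (Yu , Yv))

  absorbed-reaches : ∀ {S 𝒴 Ss v} → (∀ {u w} → SamePart H 𝒴 u w → Star (SamePart H Ss) u w) →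
                     absorb S 𝒴 v ≡ true → ∃[ s ] S s ≡ true × Star (SamePart H (S ∷ Ss)) v s
  absorbed-reaches {v = v} reach a with absorb⁻ a
  ... | inj₁ Sv = v , Sv , ε
  ... | inj₂ (Y , Y∈ , m , Yv) with meets⁻ m
  ...   | s , Y∋s , S∋s = s , S∋s , Star.map there (reach (lose Y∈ (Yv , Y∋s)))

  merge-connects : ∀ Ss {u v} → SamePart H (merge Ss) u v → Star (SamePart H Ss) u v
  merge-connects (S ∷ Ss) (here (au , av))
    with absorbed-reaches (merge-connects Ss) au | absorbed-reaches (merge-connects Ss) av
  ... | s , S∋s , u⇝s | t , S∋t , v⇝t =
    u⇝s ◅◅ here (S∋s , S∋t) ◅ Star.reverse (SamePart-sym {H} {S ∷ Ss}) v⇝t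
  merge-connects (S ∷ Ss) (there same) =
    Star.map there (merge-connects Ss (Any.filter⁻ (T? ∘ avoids S) same))

order-≤-via-model : ∀ {G H} (M : H ≼ G) 𝒳 𝒴 →
                    (∀ {h} → covered H 𝒴 h ≡ true →
                       ∃[ g ] MinorModel.branch M h g ≡ true × covered G 𝒳 g ≡ true) →
                    order H 𝒴 ≤ order G 𝒳
order-≤-via-model {G} {H} M 𝒳 𝒴 meets-⋃𝒳 =
  pigeonhole Owns owner-unique (filterᵇ (covered G 𝒳) (vertices G))
             (Unique.filter⁺ (T? ∘ covered H 𝒴) {vertices H} (unique H)) image
  where
  open MinorModel M

  Owns : V H → V G → Set
  Owns h g = branch h g ≡ true × covered G 𝒳 g ≡ true

  owner-unique : ∀ {h h' g} → Owns h g → Owns h' g → h ≡ h'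
  owner-unique {h} {h'} {g} (hg , _) (h'g , _) with vertex-≟ H h h'
  ... | yes h≡h' = h≡h'
  ... | no  h≢h' = ⊥-elim (not-¬ h'g (disjoint h h' h≢h' g hg))

  image : ∀ {h} → h ∈ filterᵇ (covered H 𝒴) (vertices H) →
          ∃[ g ] g ∈ filterᵇ (covered G 𝒳) (vertices G) × Owns h g
  image h∈ with meets-⋃𝒳 (proj₂ (∈-filterᵇ⁻ (covered H 𝒴) (vertices H) h∈))
  ... | g , hg , ⋃𝒳g = g , ∈-filterᵇ⁺ (covered G 𝒳) (complete G g) ⋃𝒳g , hg , ⋃𝒳g

Linked : ∀ {G H} → H ≼ G → List (Subset G) → V H → V H → Set
Linked {G} M 𝒳 h h' = ∃[ g ] ∃[ g' ] branch h g ≡ true × branch h' g' ≡ true × SamePart G 𝒳 g g'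
  where open MinorModel M

module ContractedModel {G H KG KH 𝒳 𝒴}
  (πG : ContractionMap G 𝒳 KG) (πH : ContractionMap H 𝒴 KH) (M : H ≼ G)
  (linked⇒same  : ∀ {h h'} → Linked M 𝒳 h h' → SamePart H 𝒴 h h')
  (same⇒linked* : ∀ {h h'} → SamePart H 𝒴 h h' → Star (Linked M 𝒳) h h') where

  open MinorModel M
  private
    module πG = ContractionMap πG
    module πH = ContractionMap πH

    _≟ᴷᴳ_ : DecidableEquality (V KG)
    _≟ᴷᴳ_ = vertex-≟ KG

    _≟ᴷᴴ_ : DecidableEquality (V KH)
    _≟ᴷᴴ_ = vertex-≟ KH

  same-image : ∀ {h h' g g'} → branch h g ≡ true → branch h' g' ≡ true →
               πG.π g ≡ πG.π g' → πH.π h ≡ πH.π h'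
  same-image {h} {h'} {g} {g'} hg h'g' eq with πG.fibre eq
  ... | inj₂ same = πH.merges (linked⇒same (g , g' , hg , h'g' , same))
  ... | inj₁ refl with vertex-≟ H h h'
  ...   | yes h≡h' = cong πH.π h≡h'
  ...   | no  h≢h' = ⊥-elim (not-¬ h'g' (disjoint h h' h≢h' g hg))

  -- The image under πG of the union of the branch sets of the fibre of a.
  β : V KH → Subset KG
  β a c = any (λ g → does (πG.π g ≟ᴷᴳ c) ∧
                     any (λ h → branch h g ∧ does (πH.π h ≟ᴷᴴ a)) (vertices H))
              (vertices G)

  β⁺ : ∀ {a h g} → branch h g ≡ true → πH.π h ≡ a → β a (πG.π g) ≡ true
  β⁺ {a} {h} {g} hg ha =
    any-≡-true⁺ _ (complete G g)
      (cong₂ _∧_ (dec-true (πG.π g ≟ᴷᴳ πG.π g) refl)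
                 (any-≡-true⁺ (λ h → branch h g ∧ does (πH.π h ≟ᴷᴴ a)) (complete H h)
                              (cong₂ _∧_ hg (dec-true (πH.π h ≟ᴷᴴ a) ha))))

  β⁻ : ∀ {a c} → β a c ≡ true → ∃[ g ] ∃[ h ] πG.π g ≡ c × branch h g ≡ true × πH.π h ≡ a
  β⁻ {a} {c} βac with any-≡-true⁻ _ (vertices G) βac
  ... | g , _ , gc∧∃h with ∧-≡-true⁻ (does (πG.π g ≟ᴷᴳ c)) gc∧∃h
  ...   | gc , ∃h with any-≡-true⁻ _ (vertices H) ∃h
  ...     | h , _ , hg∧ha with ∧-≡-true⁻ (branch h g) hg∧ha
  ...       | hg , ha = g , h , does-≡-true⁻ (πG.π g ≟ᴷᴳ c) gc , hg , does-≡-true⁻ (πH.π h ≟ᴷᴴ a) ha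

  branch-walk : ∀ {a h g g'} → πH.π h ≡ a → WalkIn G (branch h) g g' →
                WalkIn KG (β a) (πG.π g) (πG.π g')
  branch-walk ha stop = stop
  branch-walk {a} {g' = g'} ha (step {x} {y} e hy w) with πG.π x ≟ᴷᴳ πG.π y
  ... | yes πx≡πy = subst (λ z → WalkIn KG (β a) z (πG.π g')) (sym πx≡πy) (branch-walk ha w)
  ... | no  πx≢πy = step (πG.edge-preserved e πx≢πy) (β⁺ hy ha) (branch-walk ha w)

  -- Consecutive branch sets of a linked chain are glued by a contracted vertex.
  linked-walk : ∀ {a h h' g g'} → Star (Linked M 𝒳) h h' → πH.π h ≡ a →
                branch h g ≡ true → branch h' g' ≡ true → WalkIn KG (β a) (πG.π g) (πG.π g')
  linked-walk ε ha hg hg' = branch-walk ha (connected _ _ _ hg hg')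
  linked-walk {a} {g' = g'} (link@(u , u' , hu , h″u' , same) ◅ links) ha hg h'g' =
    walk-++ (branch-walk ha (connected _ _ _ hg hu))
            (subst (λ z → WalkIn KG (β a) z (πG.π g')) (sym (πG.merges same))
                   (linked-walk links (trans (sym (πH.merges (linked⇒same link))) ha) h″u' h'g'))

  β-nonempty : ∀ a → NonEmpty KG (β a)
  β-nonempty a with πH.surjective a
  ... | h , ha with nonempty h
  ...   | g , hg = πG.π g , β⁺ hg ha

  β-connected : ∀ a → ConnectedIn KG (β a)
  β-connected a c c' βc βc' with β⁻ βc | β⁻ βc'
  ... | g , h , refl , hg , ha | g' , h' , refl , h'g' , h'a =
    linked-walk (fibre⇒linked* (πH.fibre (trans ha (sym h'a)))) ha hg h'g'
    where
    fibre⇒linked* : h ≡ h' ⊎ SamePart H 𝒴 h h' → Star (Linked M 𝒳) h h'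
    fibre⇒linked* (inj₁ refl) = ε
    fibre⇒linked* (inj₂ same) = same⇒linked* same

  β-disjoint : ∀ a a' → a ≢ a' → Disjoint KG (β a) (β a')
  β-disjoint a a' a≢a' c βac = ¬-not λ βa'c → a≢a' (same-fibre (β⁻ βac) (β⁻ βa'c))
    where
    same-fibre : ∃[ g ] ∃[ h ] πG.π g ≡ c × branch h g ≡ true × πH.π h ≡ a →
                 ∃[ g ] ∃[ h ] πG.π g ≡ c × branch h g ≡ true × πH.π h ≡ a' → a ≡ a'
    same-fibre (g , h , gc , hg , ha) (g' , h' , g'c , h'g' , h'a') =
      trans (sym ha) (trans (same-image hg h'g' (trans gc (sym g'c))) h'a')

  β-edges : ∀ a a' → E KH a a' ≡ true →
            ∃[ c ] ∃[ c' ] β a c ≡ true × β a' c' ≡ true × E KG c c' ≡ true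
  β-edges a a' e with πH.edge-lift e
  ... | h , h' , ha , h'a' , hh' with edges h h' hh'
  ...   | g , g' , hg , h'g' , gg' =
    πG.π g , πG.π g' , β⁺ hg ha , β⁺ h'g' h'a' , πG.edge-preserved gg' distinct
    where
    distinct : πG.π g ≢ πG.π g'
    distinct eq with trans (sym ha) (trans (same-image hg h'g' eq) h'a')
    ... | refl = not-¬ e (E-irrefl KH a)

  contracted-model : KH ≼ KG
  contracted-model = record
    { branch    = β
    ; nonempty  = β-nonempty
    ; connected = β-connected
    ; disjoint  = β-disjoint
    ; edges     = β-edges
    }

module InducedPartition {G H : Graph} (M : H ≼ G) (𝒳 : List (Subset G)) where

  open MinorModel M
  open Merge H

  touched : Subset G → Subset H
  touched X h = any (λ g → branch h g ∧ X g) (vertices G)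

  touched⁺ : ∀ {X h g} → branch h g ≡ true → X g ≡ true → touched X h ≡ true
  touched⁺ {X} {h} {g} hg Xg = any-≡-true⁺ (λ g → branch h g ∧ X g) (complete G g) (cong₂ _∧_ hg Xg)

  touched⁻ : ∀ {X h} → touched X h ≡ true → ∃[ g ] branch h g ≡ true × X g ≡ true
  touched⁻ {X} {h} tXh with any-≡-true⁻ _ (vertices G) tXh
  ... | g , _ , hg∧Xg = g , ∧-≡-true⁻ (branch h g) hg∧Xg

  inhabited : Subset H → Bool
  inhabited Y = any Y (vertices H)

  merged : List (Subset H)
  merged = merge (map touched 𝒳)

  𝒴 : List (Subset H)
  𝒴 = filterᵇ inhabited merged

  𝒴-partition : IsPartition H 𝒴
  𝒴-partition = All.tabulate inhabited-part ,
                AllPairs.filter⁺ (T? ∘ inhabited) (merge-disjoint (map touched 𝒳))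
    where
    inhabited-part : ∀ {Y} → Y ∈ 𝒴 → NonEmpty H Y
    inhabited-part {Y} Y∈ with any-≡-true⁻ Y (vertices H) (proj₂ (∈-filterᵇ⁻ inhabited merged Y∈))
    ... | h , _ , Yh = h , Yh

  linked⇒same-touched : ∀ {h h'} → Linked M 𝒳 h h' → SamePart H (map touched 𝒳) h h'
  linked⇒same-touched (g , g' , hg , h'g' , same) with find same
  ... | X , X∈ , (Xg , Xg') = lose (∈-map⁺ touched X∈) (touched⁺ hg Xg , touched⁺ h'g' Xg')

  same-touched⇒linked : ∀ {h h'} → SamePart H (map touched 𝒳) h h' → Linked M 𝒳 h h'
  same-touched⇒linked same with find (Any.map⁻ same)
  ... | X , X∈ , (tXh , tXh') with touched⁻ tXh | touched⁻ tXh'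
  ...   | g , hg , Xg | g' , h'g' , Xg' = g , g' , hg , h'g' , lose X∈ (Xg , Xg')

  Any-𝒴⇒merged : ∀ {P : Subset H → Set} → Any P 𝒴 → Any P merged
  Any-𝒴⇒merged = Any.filter⁻ (T? ∘ inhabited)

  linked⇒same-𝒴 : ∀ {h h'} → Linked M 𝒳 h h' → SamePart H 𝒴 h h'
  linked⇒same-𝒴 {h} linked with find (merge-coarsens (map touched 𝒳) (linked⇒same-touched linked))
  ... | Y , Y∈ , (Yh , Yh') =
    lose (∈-filterᵇ⁺ inhabited Y∈ (any-≡-true⁺ Y (complete H h) Yh)) (Yh , Yh')

  same-𝒴⇒linked* : ∀ {h h'} → SamePart H 𝒴 h h' → Star (Linked M 𝒳) h h'
  same-𝒴⇒linked* same =
    Star.map same-touched⇒linked (merge-connects (map touched 𝒳) (Any-𝒴⇒merged same))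

  covered-𝒴⇒meets-⋃𝒳 : ∀ {h} → covered H 𝒴 h ≡ true →
                        ∃[ g ] branch h g ≡ true × covered G 𝒳 g ≡ true
  covered-𝒴⇒meets-⋃𝒳 {h} ⋃𝒴h with any-≡-true⁻ (λ Y → Y h) 𝒴 ⋃𝒴h
  ... | Y , Y∈ , Yh
    with find (Any.map⁻ {f = touched} (merge-covered (map touched 𝒳) (Any-𝒴⇒merged (lose Y∈ Yh))))
  ...   | X , X∈ , tXh with touched⁻ tXh
  ...     | g , hg , Xg = g , hg , any-≡-true⁺ (λ X → X g) X∈ Xg

  𝒴-order : order H 𝒴 ≤ order G 𝒳
  𝒴-order = order-≤-via-model M 𝒳 𝒴 covered-𝒴⇒meets-⋃𝒳

  contracted-minor : IsPartition G 𝒳 → (H //* 𝒴) ≼ (G //* 𝒳)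
  contracted-minor 𝒳-partition =
    ContractedModel.contracted-model (//*-contraction 𝒳-partition) (//*-contraction 𝒴-partition) M
                                     linked⇒same-𝒴 same-𝒴⇒linked*

lemma2p1 : (ℋ : Graph → Set) → MinorClosed ℋ → (k : ℕ) → MinorClosed (ℋ ^[ k ])
lemma2p1 ℋ ℋ-minor-closed k G H (𝒳 , 𝒳-partition , 𝒳-order , G//𝒳∈ℋ) H≼G =
  𝒴 , 𝒴-partition , ≤-trans 𝒴-order 𝒳-order ,
  ℋ-minor-closed (G //* 𝒳) (H //* 𝒴) G//𝒳∈ℋ (contracted-minor 𝒳-partition)
  where open InducedPartition H≼G 𝒳
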